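{- For every execution graph $G$, thread $T$, iteration index $q$ and step $t$: if $t\in[\mathit{start}_G^T(q),\mathit{end}_G^T(q))$, then $P_T(k_G^T(t))$ is not an $\mathtt{await}$ statement.
   Context: Fix finite sets $\mathit{Register}$, $\mathit{Location}$, $\mathit{Value}$ and a finite set of threads $\mathcal T$. A state is a function $\sigma:\mathit{Register}\to\mathit{Value}$; an update is a partial function $\mu:\mathit{Register}\rightharpoonup\mathit{Value}$, and $(\sigma\ll\mu)(r)=\mu(r)$ if $r\in\mathrm{Dom}(\mu)$, else $\sigma(r)$. Events are $R^m(x)$, $W^m(x,v)$, $F^m$, and the error event $E$, with $m\in\{\mathrm{rlx},\mathrm{rel},\mathrm{acq},\mathrm{sc}\}$. A program $P$ gives each $T\in\mathcal T$ a finite sequence $P_T(0),\dots,P_T(|P_T|-1)$ of statements, each either $\mathtt{step}(\epsilon,\delta)$ with $\epsilon:\mathit{State}\to\mathit{Event}$, $\delta:\mathit{State}\times(\mathit{Value}\cup\{\bot\})\to\mathit{Update}$, or $\mathtt{await}(n,\kappa)$ with $n\in\mathbb N$, $\kappa:\mathit{State}\to\{0,1\}$; whenever $P_T(k)=\mathtt{await}(n,\kappa)$ we have $n\le k$ and no $P_T(k')$ with $k'\in[k-n,k)$ is an await. An execution graph $G$ consists of a set $G.\mathrm{E}$ of triples $\langle T,t,e\rangle$ (thread, index, event), a reads-from relation $G.\mathrm{rf}$ (each read has at most one incoming edge from a write; $G.\mathrm{rf}(r)$ is that write or $\bot$), and a modification order; $w.\mathrm{val}$ is the value of write $w$. Thread-local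 semantics relative to $G$: $k_G^T(0)=0$, $\sigma_G^T(0)$ a fixed initial state. If $k_G^T(t)\ge|P_T|$ or no triple $\langle T,t,\cdot\rangle$ is in $G.\mathrm{E}$, then the number of steps is $N_G^T=t$. Otherwise step $t$ executes $S=P_T(k_G^T(t))$. If $S=\mathtt{await}(n,\kappa)$: $e_G^T(t)=F^{\mathrm{rlx}}$, $\sigma_G^T(t+1)=\sigma_G^T(t)$, and $k_G^T(t+1)=k_G^T(t)+1$ if $\kappa(\sigma_G^T(t))=0$, else $k_G^T(t)-n$. If $S=\mathtt{step}(\epsilon,\delta)$: $e_G^T(t)=\epsilon(\sigma_G^T(t))$, $k_G^T(t+1)=k_G^T(t)+1$; $v_G^T(t)$ is the value of the write $G.\mathrm{rf}(\langle T,t,e_G^T(t)\rangle)$ if $e_G^T(t)$ is a read with an incoming rf-edge, else $\bot$; if $e_G^T(t)$ is not a read or $v_G^T(t)\neq\bot$ then $\sigma_G^T(t+1)=\sigma_G^T(t)\ll\delta(\sigma_G^T(t),v_G^T(t))$, otherwise $\sigma_G^T(t+1)=\sigma_G^T(t)$ and $N_G^T=t+1$. Await iterations: $\mathit{end}_G^T(0)<\mathit{end}_G^T(1)<\cdots$ enumerate the steps $t$ at which $P_T(k_G^T(t))$ is an await; $\mathit{len}_G^T(q)=n$ where $P_T(k_G^T(\mathit{end}_G^T(q)))=\mathtt{await}(n,\kappa)$; $\mathit{start}_G^T(q)=\mathit{end}_G^T(q)-\mathit{len}_G^T(q)$. -}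

module Defs where

open import Data.Nat using (ℕ; zero; suc; _+_; _∸_; _≤_; _<_)
open import Data.Fin using (Fin)
open import Data.Bool using (Bool; true; false; if_then_else_)
open import Data.Maybe using (Maybe; just; nothing)
open import Data.List using (List; []; _∷_; length)
open import Data.Product using (Σ; ∃; _×_; _,_; proj₂)
open import Data.Sum using (_⊎_)
open import Relation.Binary.PropositionalEquality using (_≡_)
open import Relation.Nullary using (¬_)

data Mode : Set where
  rlx rel acq sc : Mode

module _ {nR nL nV nT : ℕ} where

  Register Location Value Thread : Set
  Register = Fin nR
  Location = Fin nL
  Value    = Fin nV
  Thread   = Fin nT

  State : Set
  State = Register → Value

  Update : Set
  Update = Register → Maybe Value

  _≪_ : State → Update → State
  (σ ≪ μ) r with μ r
  ... | just v  = v
  ... | nothing = σ r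

  data Event : Set where
    R : Mode → Location → Event
    W : Mode → Location → Value → Event
    F : Mode → Event
    E : Event

  isRead : Event → Bool
  isRead (R _ _) = true
  isRead _       = false

  -- statements; κ : State → {0,1} is rendered with Bool (false = 0, true = 1);
  -- the argument ⊥ of δ is rendered as nothing
  data Stmt : Set where
    step  : (State → Event) → (State → Maybe Value → Update) → Stmt
    await : ℕ → (State → Bool) → Stmt

  at : List Stmt → ℕ → Maybe Stmt
  at []       _       = nothing
  at (S ∷ Ss) zero    = just S
  at (S ∷ Ss) (suc k) = at Ss k

  Program : Set
  Program = Thread → List Stmt

  IsAwaitAt : List Stmt → ℕ → Set
  IsAwaitAt Ss k = Σ ℕ λ n → Σ (State → Bool) λ κ → at Ss k ≡ just (await n κ)

  -- standing assumption on programs: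
  -- P_T(k) = await(n,κ) ⇒ n ≤ k and no P_T(k') with k' ∈ [k-n,k) is an await
  WellFormed : Program → Set
  WellFormed P = ∀ T k n κ → at (P T) k ≡ just (await n κ) →
                 n ≤ k × (∀ k' → k ∸ n ≤ k' → k' < k → ¬ IsAwaitAt (P T) k')

  Triple : Set
  Triple = Thread × ℕ × Event

  isWrite : Event → Bool
  isWrite (W _ _ _) = true
  isWrite _         = false

  -- execution graphs: event set, reads-from (as a partial function from reads
  -- to writes, so each read has at most one incoming rf edge), modification order
  record ExecGraph : Set₁ where
    field
      Ev : Triple → Set
      rf : Triple → Maybe Triple
      rf-wf : ∀ r w → rf r ≡ just w →
              Ev r × Ev w × isRead (proj₂ (proj₂ r)) ≡ true
                         × isWrite (proj₂ (proj₂ w)) ≡ true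
      mo : Triple → Triple → Set

  valOf : Maybe Triple → Maybe Value
  valOf (just (_ , _ , W _ _ v)) = just v
  valOf _                        = nothing

  readVal : ExecGraph → Thread → ℕ → Event → Maybe Value
  readVal G T t e with isRead e
  ... | true  = valOf (ExecGraph.rf G (T , t , e))
  ... | false = nothing

  -- the thread does not get stuck after executing event e (not a read, or rf-value ≠ ⊥)
  Continues : ExecGraph → Thread → ℕ → Event → Set
  Continues G T t e = (isRead e ≡ false) ⊎ (Σ Value λ v → readVal G T t e ≡ just v)

  HasEv : ExecGraph → Thread → ℕ → Set
  HasEv G T t = Σ Event λ e → ExecGraph.Ev G (T , t , e)

  -- Live σ₀ P G T t k σ : step t of thread T is executed (t < N_G^T), with
  -- k_G^T(t) = k and σ_G^T(t) = σ, where σ₀ is the initial state.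
  data Live (σ₀ : State) (P : Program) (G : ExecGraph) (T : Thread) : ℕ → ℕ → State → Set where
    live0 : 0 < length (P T) → HasEv G T 0 → Live σ₀ P G T 0 0 σ₀
    live-await : ∀ {t k σ n κ} → Live σ₀ P G T t k σ → at (P T) k ≡ just (await n κ) →
                 let k' = if κ σ then k ∸ n else suc k in
                 k' < length (P T) → HasEv G T (suc t) → Live σ₀ P G T (suc t) k' σ
    live-step : ∀ {t k σ ε δ} → Live σ₀ P G T t k σ → at (P T) k ≡ just (step ε δ) →
                Continues G T t (ε σ) →
                suc k < length (P T) → HasEv G T (suc t) →
                Live σ₀ P G T (suc t) (suc k) (σ ≪ δ σ (readVal G T t (ε σ)))

  data NumAwaits (σ₀ : State) (P : Program) (G : ExecGraph) (T : Thread) : ℕ → ℕ → Set where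
    na0    : NumAwaits σ₀ P G T 0 0
    na-aw  : ∀ {t c k σ} → NumAwaits σ₀ P G T t c → Live σ₀ P G T t k σ →
             IsAwaitAt (P T) k → NumAwaits σ₀ P G T (suc t) (suc c)
    na-st  : ∀ {t c k σ} → NumAwaits σ₀ P G T t c → Live σ₀ P G T t k σ →
             ¬ IsAwaitAt (P T) k → NumAwaits σ₀ P G T (suc t) c

  -- end_G^T(q) = e and len_G^T(q) = n
  record EndLen (σ₀ : State) (P : Program) (G : ExecGraph) (T : Thread) (q e n : ℕ) : Set where
    field
      k     : ℕ
      σ     : State
      κ     : State → Bool
      live  : Live σ₀ P G T e k σ
      isAw  : at (P T) k ≡ just (await n κ)
      count : NumAwaits σ₀ P G T e q

module Submission where

-- Runs are deterministic, so the run of T can be retraced backwards from the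
-- end e of the iteration.  Going back d ≤ n steps from the await at program
-- point k_e, the previous step is never an await: one that falls through to
-- k_e − d would sit in the await-free window [k_e − n, k_e) of the await at
-- k_e; one that jumps back from k < k_e lies in that window as well; one at
-- k_e itself jumps exactly n steps back; and one at k > k_e has k_e in its own
-- await-free window.  Hence step e − d runs program point k_e − d, which for
-- 1 ≤ d ≤ n lies in the await-free window.

open import Defs
open import Data.Nat using (ℕ; zero; suc; _+_; _∸_; _≤_; _<_; s≤s)
open import Data.Nat.Properties
open import Data.Fin using (Fin)
open import Data.Bool using (Bool; true; false; if_then_else_)
open import Data.Maybe using (just)
open import Data.Product using (Σ; _×_; _,_; proj₁; proj₂)
open import Data.Empty using (⊥; ⊥-elim)
open import Relation.Nullary using (¬_)
open import Relation.Binary using (tri<; tri≈; tri>)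
open import Relation.Binary.PropositionalEquality

m+n≡o⇒n≤p⇒o∸p≤m : ∀ {m n o} p → m + n ≡ o → n ≤ p → o ∸ p ≤ m
m+n≡o⇒n≤p⇒o∸p≤m {m} {n} p refl n≤p = begin
  (m + n) ∸ p ≤⟨ ∸-monoʳ-≤ (m + n) n≤p ⟩
  (m + n) ∸ n ≡⟨ m+n∸n≡m m n ⟩
  m           ∎
  where open ≤-Reasoning

m∸n≤o⇒m∸o≤n : ∀ m n o → m ∸ n ≤ o → m ∸ o ≤ n
m∸n≤o⇒m∸o≤n m n o m∸n≤o = m≤n+o⇒m∸n≤o m o (begin
  m           ≤⟨ m≤n+m∸n m n ⟩
  n + (m ∸ n) ≤⟨ +-monoʳ-≤ n m∸n≤o ⟩
  n + o       ≡⟨ +-comm n o ⟩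
  o + n       ∎)
  where open ≤-Reasoning

module Run {nR nL nV nT : ℕ} (σ₀ : State {nR} {nL} {nV} {nT}) (P : Program {nR} {nL} {nV} {nT})
           (G : ExecGraph {nR} {nL} {nV} {nT}) (T : Fin nT) where

  Live-functional : ∀ {t k k′ σ σ′} → Live σ₀ P G T t k σ → Live σ₀ P G T t k′ σ′ →
                    k ≡ k′ × σ ≡ σ′
  Live-functional (live0 _ _) (live0 _ _) = refl , refl
  Live-functional (live-await l a _ _) (live-await l′ a′ _ _) with Live-functional l l′
  ... | refl , refl with trans (sym a) a′
  ... | refl = refl , refl
  Live-functional (live-await l a _ _) (live-step l′ a′ _ _ _) with Live-functional l l′
  ... | refl , refl with trans (sym a) a′
  ... | ()
  Live-functional (live-step l a _ _ _) (live-await l′ a′ _ _) with Live-functional l l′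
  ... | refl , refl with trans (sym a) a′
  ... | ()
  Live-functional (live-step l a _ _ _) (live-step l′ a′ _ _ _) with Live-functional l l′
  ... | refl , refl with trans (sym a) a′
  ... | refl = refl , refl

  module AwaitWindow (wf : WellFormed P) {kₑ n κₑ} (awₑ : at (P T) kₑ ≡ just (await n κₑ)) where

    no-await-in-window : ∀ j → kₑ ∸ n ≤ j → j < kₑ → ¬ IsAwaitAt (P T) j
    no-await-in-window = proj₂ (wf T kₑ n κₑ awₑ)

    fallthrough-not-into-window : ∀ {k m κ d} → at (P T) k ≡ just (await m κ) →
                                  d < n → suc k + d ≡ kₑ → ⊥
    fallthrough-not-into-window {k} {m} {κ} {d} aw d<n eq =
      no-await-in-window k (m+n≡o⇒n≤p⇒o∸p≤m n (trans (+-suc k d) eq) d<n)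
                           (≤-trans (s≤s (m≤m+n k d)) (≤-reflexive eq)) (m , κ , aw)

    jump-not-into-window : ∀ {k m κ d} → at (P T) k ≡ just (await m κ) →
                           d < n → k ∸ m + d ≡ kₑ → ⊥
    jump-not-into-window {k} {m} {κ} {d} aw d<n eq with <-cmp k kₑ
    ... | tri< k<kₑ _ _ =
      no-await-in-window k (≤-trans (m+n≡o⇒n≤p⇒o∸p≤m n eq (<⇒≤ d<n)) (m∸n≤m k m)) k<kₑ (m , κ , aw)
    ... | tri≈ _ refl _ with trans (sym aw) awₑ
    ... | refl = <-irrefl eq (begin-strict
      k ∸ n + d <⟨ +-monoʳ-< (k ∸ n) d<n ⟩
      k ∸ n + n ≡⟨ m∸n+n≡m (proj₁ (wf T k n κ aw)) ⟩
      k         ∎)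
      where open ≤-Reasoning
    jump-not-into-window {k} {m} {κ} {d} aw d<n eq | tri> _ _ kₑ<k =
      proj₂ (wf T k m κ aw) kₑ (≤-trans (m≤m+n (k ∸ m) d) (≤-reflexive eq)) kₑ<k (n , κₑ , awₑ)

    await-not-into-window : ∀ {k m κ d} (b : Bool) → at (P T) k ≡ just (await m κ) →
                            d < n → (if b then k ∸ m else suc k) + d ≡ kₑ → ⊥
    await-not-into-window true  = jump-not-into-window
    await-not-into-window false = fallthrough-not-into-window

    Live-rewind : ∀ {e σₑ} → Live σ₀ P G T e kₑ σₑ →
                  ∀ d → d ≤ n → ∀ s → s + d ≡ e →
                  Σ ℕ λ k → Σ (State {nR} {nL} {nV} {nT}) λ σ → Live σ₀ P G T s k σ × k + d ≡ kₑ
    Live-rewind {σₑ = σₑ} lₑ zero _ s refl rewrite +-identityʳ s = kₑ , σₑ , lₑ , +-identityʳ kₑ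
    Live-rewind lₑ (suc d) d<n s eq with Live-rewind lₑ d (<⇒≤ d<n) (suc s) (trans (sym (+-suc s d)) eq)
    ... | _ , _ , live-await {σ = σ} {κ = κ} _ aw _ _ , eq′ = ⊥-elim (await-not-into-window (κ σ) aw d<n eq′)
    ... | _ , _ , live-step {k = k} l _ _ _ _ , eq′ = k , _ , l , trans (+-suc k d) eq′

    no-await-before-end : ∀ {e σₑ} → Live σ₀ P G T e kₑ σₑ →
                          ∀ t → e ∸ n ≤ t → t < e →
                          ∀ k σ → Live σ₀ P G T t k σ → ¬ IsAwaitAt (P T) k
    no-await-before-end {e} lₑ t e∸n≤t t<e k _ lₜ
      with Live-rewind lₑ (e ∸ t) (m∸n≤o⇒m∸o≤n e n t e∸n≤t) t (m+[n∸m]≡n (<⇒≤ t<e))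
    ... | _ , _ , l , k+d≡kₑ with Live-functional lₜ l
    ... | refl , refl = no-await-in-window k (m+n≡o⇒n≤p⇒o∸p≤m n k+d≡kₑ (m∸n≤o⇒m∸o≤n e n t e∸n≤t))
                          (≤-trans (m<m+n k (m<n⇒0<n∸m t<e)) (≤-reflexive k+d≡kₑ))

lemma2 : ∀ {nR nL nV nT : ℕ} (σ₀ : State {nR} {nL} {nV} {nT}) (P : Program {nR} {nL} {nV} {nT}) →
    WellFormed P →
    ∀ (G : ExecGraph {nR} {nL} {nV} {nT}) (T : Fin nT) (q e n : ℕ) →
    EndLen σ₀ P G T q e n →
    ∀ (t : ℕ) → e ∸ n ≤ t → t < e →
    ∀ (k : ℕ) (σ : State {nR} {nL} {nV} {nT}) → Live σ₀ P G T t k σ →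
    ¬ IsAwaitAt (P T) k
lemma2 σ₀ P wf G T q e n el =
  Run.AwaitWindow.no-await-before-end σ₀ P G T wf (EndLen.isAw el) (EndLen.live el)
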